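{- Let $P$ be a polytope. Then the clique number $\omega(M)$ of the rectangle graph of $M$ is the same for every non-incidence matrix $M$ of $P$.
   Context: A non-incidence matrix of $P$ is a 0/1-matrix whose rows are indexed by some set of faces of $P$ including all facets and whose columns are indexed by some set of nonempty faces of $P$ including all vertices, with entry $1$ at $(F,G)$ iff $F$ does not contain $G$. The rectangle graph $G(M)$ of a real matrix $M$ has as vertices the pairs $(i,j)$ with $M_{i,j}\neq 0$; two vertices $(i,j),(k,\ell)$ are adjacent iff $M_{i,\ell}=0$ or $M_{k,j}=0$. $\omega(M)$ is the clique number of $G(M)$. -}

module Defs where

open import Level using (Level; _⊔_; suc)
open import Data.Nat using (ℕ; _≤_)
open import Data.Fin using (Fin)
import Data.Fin as Fin
open import Data.Product using (Σ; ∃; _×_; _,_; proj₁; proj₂)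
open import Data.Sum using (_⊎_)
open import Relation.Nullary using (¬_)
open import Relation.Binary.PropositionalEquality using (_≡_)
open import Algebra.Bundles using (CommutativeRing)

-- Ordered fields (the stdlib has no reals; we work over an arbitrary
-- ordered field, of which ℝ is the motivating instance).

record OrderedField (c ℓ₁ ℓ₂ : Level) : Set (Level.suc (c ⊔ ℓ₁ ⊔ ℓ₂)) where
  field
    commutativeRing : CommutativeRing c ℓ₁
  open CommutativeRing commutativeRing public
  field
    _≤F_      : Carrier → Carrier → Set ℓ₂
    ≤-refl    : ∀ {x y} → x ≈ y → x ≤F y
    ≤-trans   : ∀ {x y z} → x ≤F y → y ≤F z → x ≤F z
    ≤-antisym : ∀ {x y} → x ≤F y → y ≤F x → x ≈ y
    ≤-total   : ∀ x y → x ≤F y ⊎ y ≤F x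
    +-mono    : ∀ {x y} z → x ≤F y → (x + z) ≤F (y + z)
    *-nonneg  : ∀ {x y} → 0# ≤F x → 0# ≤F y → 0# ≤F (x * y)
    0≉1       : ¬ (0# ≈ 1#)
    inverse   : ∀ x → ¬ (x ≈ 0#) → Σ Carrier λ y → (x * y) ≈ 1#

module Polytope {c ℓ₁ ℓ₂} (K : OrderedField c ℓ₁ ℓ₂) where
  open OrderedField K

  Point : ℕ → Set c
  Point d = Fin d → Carrier

  dot : ∀ {d} → Point d → Point d → Carrier
  dot {ℕ.zero}  x y = 0#
  dot {ℕ.suc d} x y = (x Fin.zero * y Fin.zero) + dot (λ i → x (Fin.suc i)) (λ i → y (Fin.suc i))

  -- The polytope P = conv {V 0, …, V (n-1)} ⊆ K^d is given by the
  -- finite point list V.  A face of P is P ∩ {x | ⟨a,x⟩ = b} for a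
  -- valid inequality ⟨a,x⟩ ≤ b of P (this includes ∅ and P itself).
  -- Since every face of conv V equals conv (V ∩ face), a face is
  -- determined by the set of indices i with V i in the face, and
  -- containment of faces is inclusion of these index sets.
  record Face {d n : ℕ} (V : Fin n → Point d) : Set (c ⊔ ℓ₁ ⊔ ℓ₂) where
    constructor face
    field
      normal : Point d
      rhs    : Carrier
      valid  : ∀ i → dot normal (V i) ≤F rhs

  InFace : ∀ {d n} (V : Fin n → Point d) → Face V → Fin n → Set ℓ₁
  InFace V F i = dot (Face.normal F) (V i) ≈ Face.rhs F

  _⊇F_ : ∀ {d n} {V : Fin n → Point d} → Face V → Face V → Set ℓ₁
  _⊇F_ {V = V} F G = ∀ i → dot (Face.normal G) (V i) ≈ Face.rhs G
                           → dot (Face.normal F) (V i) ≈ Face.rhs F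

  _≈F_ : ∀ {d n} {V : Fin n → Point d} → Face V → Face V → Set ℓ₁
  F ≈F G = (F ⊇F G) × (G ⊇F F)

  module _ {d n : ℕ} (V : Fin n → Point d) where

    IsWhole : Face V → Set ℓ₁
    IsWhole F = ∀ i → InFace V F i

    IsProper : Face V → Set ℓ₁
    IsProper F = ¬ IsWhole F

    IsFacet : Face V → Set (c ⊔ ℓ₁ ⊔ ℓ₂)
    IsFacet F = IsProper F × (∀ (G : Face V) → IsProper G → G ⊇F F → G ≈F F)

    IsNonempty : Face V → Set ℓ₁
    IsNonempty F = ∃ λ i → InFace V F i

    IsVertex : Face V → Set (ℓ₁)
    IsVertex F = IsNonempty F
               × (∀ i j → InFace V F i → InFace V F j → ∀ k → V i k ≈ V j k)

    -- A non-incidence matrix of P: rows indexed by a set of faces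
    -- including all facets, columns by a set of nonempty faces including
    -- all vertices; the entry at (F,G) is 1 iff F does not contain G
    -- (and 0 otherwise).
    record NonIncidenceMatrix : Set (c ⊔ ℓ₁ ⊔ ℓ₂) where
      field
        nrows ncols : ℕ
        row : Fin nrows → Face V
        col : Fin ncols → Face V
        row-injective : ∀ i i' → row i ≈F row i' → i ≡ i'
        col-injective : ∀ j j' → col j ≈F col j' → j ≡ j'
        col-nonempty  : ∀ j → IsNonempty (col j)
        has-facets    : ∀ F → IsFacet F → ∃ λ i → row i ≈F F
        has-vertices  : ∀ G → IsVertex G → ∃ λ j → col j ≈F G

      IsZero : Fin nrows → Fin ncols → Set ℓ₁
      IsZero i j = row i ⊇F col j

-- Rectangle graph and clique number of a matrix, given by its zero
-- pattern  Z i j  ("M i j = 0") on an r × s index set.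

module Rectangle {ℓ} {r s : ℕ} (Z : Fin r → Fin s → Set ℓ) where

  IsRGVertex : Fin r × Fin s → Set ℓ
  IsRGVertex (i , j) = ¬ Z i j

  RGAdj : Fin r × Fin s → Fin r × Fin s → Set ℓ
  RGAdj (i , j) (k , l) = Z i l ⊎ Z k j

  IsClique : (m : ℕ) → (Fin m → Fin r × Fin s) → Set ℓ
  IsClique m x = (∀ a b → x a ≡ x b → a ≡ b)
               × (∀ a → IsRGVertex (x a))
               × (∀ a b → ¬ (a ≡ b) → RGAdj (x a) (x b))

  HasClique : ℕ → Set ℓ
  HasClique m = ∃ λ (x : Fin m → Fin r × Fin s) → IsClique m x

  IsCliqueNumber : ℕ → Set ℓ
  IsCliqueNumber k = HasClique k × (∀ m → HasClique m → m ≤ k)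

module _ {c ℓ₁ ℓ₂} (K : OrderedField c ℓ₁ ℓ₂) where
  open Polytope K

  ωIs : ∀ {d n} {V : Fin n → Point d} → NonIncidenceMatrix V → ℕ → Set ℓ₁
  ωIs M k = Rectangle.IsCliqueNumber (NonIncidenceMatrix.IsZero M) k

{-# OPTIONS --safe #-}
module Submission where

open import Defs
open import Level using (Level; _⊔_)
open import Data.Nat using (ℕ)
open import Data.Fin using (Fin)
open import Relation.Binary.PropositionalEquality using (_≡_)

import Data.Nat as ℕ
import Data.Nat.Properties as ℕ
import Data.Nat.Induction as ℕ
open import Data.Fin using (zero; suc; _≟_)
open import Data.Fin.Properties using (¬∀⟶∃¬)
open import Data.List using (List; []; _∷_; length; filter; allFin)
open import Data.List.Properties using (filter-notAll)
open import Data.List.Membership.Propositional using (_∈_)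
open import Data.List.Membership.Propositional.Properties using (∈-allFin; ∈-filter⁺)
open import Data.List.Relation.Unary.Any using (here; there)
import Data.List.Relation.Unary.Any as Any
open import Data.Product using (Σ; ∃; _×_; _,_; proj₁; proj₂)
open import Data.Sum using (_⊎_; inj₁; inj₂; [_,_]′)
open import Function using (_∘_; _on_)
open import Function.Bundles using (_⇔_; mk⇔; Equivalence)
open import Induction.WellFounded using (Acc; acc)
import Relation.Binary.Construct.On as On
open import Relation.Binary.Bundles using (Preorder)
import Relation.Binary.PropositionalEquality as ≡
open import Relation.Nullary using (¬_; yes; no; contradiction; ¬?)
open import Relation.Nullary.Negation using (DoubleNegation; contraposition)
open import Relation.Nullary.Decidable using (decidable-stable; ¬¬-excluded-middle)
open import Relation.Unary using (Pred; Decidable)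
import Algebra.Properties.Ring as RingProperties
import Algebra.Properties.AbelianGroup as AbelianGroupProperties
import Algebra.Solver.Ring.NaturalCoefficients.Default as SemiringSolver

-- A nonzero entry (F, G) of a non-incidence matrix means that some point v of G lies
-- outside F.  Then F lies in a facet X avoiding v, and G contains a vertex w having a
-- point outside X.  Every non-incidence matrix has all facets among its rows and all
-- vertices among its columns, so replacing each entry (F, G) of a clique by such an
-- entry (X, w) turns it into a clique of any other non-incidence matrix: nonzeros stay
-- nonzero, and a zero F ⊇ G' becomes the zero X ⊇ F ⊇ G' ⊇ w'.  Hence the clique
-- numbers of any two non-incidence matrices bound each other.
--
-- The facet X is reached by growing F through faces avoiding v: a proper face strictly
-- above the current face X either avoids v, or can be rotated around X into one that
-- does.  The vertex w is cut out of G by minimising the normal of X over G and then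
-- each coordinate in turn.  These arguments are classical; they run in the
-- double-negation monad, which suffices because the final inequality between clique
-- numbers is decidable.

module _ {a b} {A : Set a} {B : Set b} where

  infixl 1 _>>=_
  _>>=_ : DoubleNegation A → (A → DoubleNegation B) → DoubleNegation B
  (¬¬a >>= f) ¬b = ¬¬a (λ a → f a ¬b)

  ¬¬-¬→ : ¬ (A → B) → DoubleNegation (A × ¬ B)
  ¬¬-¬→ ¬a→b ¬[a×¬b] = ¬a→b (λ a → contradiction (a , λ b → ¬a→b (λ _ → b)) ¬[a×¬b])

return : ∀ {a} {A : Set a} → A → DoubleNegation A
return a ¬a = ¬a a

¬¬-∀-Fin : ∀ {p} n {P : Pred (Fin n) p} → (∀ i → DoubleNegation (P i)) → DoubleNegation (∀ i → P i)
¬¬-∀-Fin ℕ.zero    ¬¬P ¬∀P = ¬∀P (λ ())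
¬¬-∀-Fin (ℕ.suc n) ¬¬P =
  ¬¬P zero >>= λ P₀ → ¬¬-∀-Fin n (¬¬P ∘ suc) >>= λ P₊ →
  return λ { zero → P₀ ; (suc i) → P₊ i }

¬¬-decidable : ∀ {p} {n} (P : Pred (Fin n) p) → DoubleNegation (Decidable P)
¬¬-decidable P = ¬¬-∀-Fin _ (λ _ → ¬¬-excluded-middle)

¬¬-¬∀⇒∃¬ : ∀ {p} {n} {P : Pred (Fin n) p} → ¬ (∀ i → P i) → DoubleNegation (∃ λ i → ¬ P i)
¬¬-¬∀⇒∃¬ {P = P} ¬∀P = ¬¬-decidable P >>= λ P? → return (¬∀⟶∃¬ _ P P? ¬∀P)

module OrderedFieldProperties {c ℓ₁ ℓ₂} (K : OrderedField c ℓ₁ ℓ₂) where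
  open OrderedField K hiding (zero)
  open RingProperties ring using (-‿distribˡ-*; -‿distribʳ-*)
  open AbelianGroupProperties +-abelianGroup
    using (⁻¹-involutive; ⁻¹-∙-comm; ε⁻¹≈ε; //-rightDividesˡ; x∙y⁻¹≈ε⇒x≈y)
  open SemiringSolver commutativeSemiring using (solve; _:+_; _:*_; _:=_)

  ≤-preorder : Preorder c ℓ₁ ℓ₂
  ≤-preorder = record
    { Carrier    = Carrier
    ; _≈_        = _≈_
    ; _≲_        = _≤F_
    ; isPreorder = record { isEquivalence = isEquivalence ; reflexive = ≤-refl ; trans = ≤-trans }
    }

  open import Relation.Binary.Reasoning.Preorder ≤-preorder public

  y-x+x≈y : ∀ x y → y - x + x ≈ y
  y-x+x≈y = //-rightDividesˡ

  x≤y⇒0≤y-x : ∀ {x y} → x ≤F y → 0# ≤F (y - x)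
  x≤y⇒0≤y-x {x} {y} x≤y = begin
    0#     ≈⟨ -‿inverseʳ x ⟨
    x - x  ≲⟨ +-mono (- x) x≤y ⟩
    y - x  ∎

  0≤y-x⇒x≤y : ∀ {x y} → 0# ≤F (y - x) → x ≤F y
  0≤y-x⇒x≤y {x} {y} 0≤y-x = begin
    x            ≈⟨ +-identityˡ x ⟨
    0# + x       ≲⟨ +-mono x 0≤y-x ⟩
    y - x + x    ≈⟨ y-x+x≈y x y ⟩
    y            ∎

  y-x≈0⇒y≈x : ∀ {x y} → y - x ≈ 0# → y ≈ x
  y-x≈0⇒y≈x {x} {y} = x∙y⁻¹≈ε⇒x≈y y x

  *-monoˡ-≤-nonneg : ∀ {x y z} → 0# ≤F z → x ≤F y → (x * z) ≤F (y * z)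
  *-monoˡ-≤-nonneg {x} {y} {z} 0≤z x≤y = 0≤y-x⇒x≤y (begin
    0#                ≲⟨ *-nonneg (x≤y⇒0≤y-x x≤y) 0≤z ⟩
    (y - x) * z       ≈⟨ distribʳ z y (- x) ⟩
    y * z + - x * z   ≈⟨ +-congˡ (-‿distribˡ-* x z) ⟨
    y * z - x * z     ∎)

  divide : ∀ x {y} → ¬ y ≈ 0# → Σ Carrier λ q → q * y ≈ x
  divide x {y} y≉0 = x * y⁻¹ , (begin-equality
    x * y⁻¹ * y     ≈⟨ *-assoc x y⁻¹ y ⟩
    x * (y⁻¹ * y)   ≈⟨ *-congˡ (*-comm y⁻¹ y) ⟩
    x * (y * y⁻¹)   ≈⟨ *-congˡ (proj₂ (inverse y y≉0)) ⟩
    x * 1#          ≈⟨ *-identityʳ x ⟩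
    x               ∎)
    where y⁻¹ = proj₁ (inverse y y≉0)

  -x--y≈y-x : ∀ x y → - x - - y ≈ y - x
  -x--y≈y-x x y = trans (+-congˡ (⁻¹-involutive y)) (+-comm (- x) y)

  -‿+-homo : ∀ x y → - (x + y) ≈ - x + - y
  -‿+-homo x y = sym (⁻¹-∙-comm x y)

  -0≈0 : - 0# ≈ 0#
  -0≈0 = ε⁻¹≈ε

  combination-difference : ∀ x y b e b' e' →
    (x * b + y * e) - (x * b' + y * e') ≈ x * (b - b') + y * (e - e')
  combination-difference x y b e b' e' = begin-equality
    (x * b + y * e) - (x * b' + y * e')           ≈⟨ +-congˡ (-‿+-homo (x * b') (y * e')) ⟩
    (x * b + y * e) + (- (x * b') + - (y * e'))   ≈⟨ +-congˡ (+-cong (-‿distribʳ-* x b') (-‿distribʳ-* y e')) ⟩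
    (x * b + y * e) + (x * - b' + y * - e')       ≈⟨ law x y b e (- b') (- e') ⟩
    x * (b - b') + y * (e - e')                   ∎
    where
    law = solve 6 (λ x y b e nb ne →
                     ((x :* b :+ y :* e) :+ (x :* nb :+ y :* ne)) := (x :* (b :+ nb) :+ y :* (e :+ ne))) refl

  upper-bound : ∀ n (f : Fin n → Carrier) → ∃ λ T → ∀ i → f i ≤F T
  upper-bound ℕ.zero    f = 0# , λ ()
  upper-bound (ℕ.suc n) f with upper-bound n (f ∘ suc)
  ... | T , f₊≤T with ≤-total (f zero) T
  ...   | inj₁ f₀≤T = T , λ { zero → f₀≤T ; (suc i) → f₊≤T i }
  ...   | inj₂ T≤f₀ = f zero , λ { zero → ≤-refl refl ; (suc i) → ≤-trans (f₊≤T i) T≤f₀ }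

  record Minimiser {p} {n} (P : Pred (Fin n) p) (f : Fin n → Carrier) : Set (p ⊔ ℓ₂) where
    field
      point   : Fin n
      holds   : P point
      minimal : ∀ i → P i → f point ≤F f i

  module _ {p} {n} {P : Pred (Fin (ℕ.suc n)) p} {f : Fin (ℕ.suc n) → Carrier} where
    open Minimiser

    minimiser-zero : P zero → (∀ i → P (suc i) → f zero ≤F f (suc i)) → Minimiser P f
    minimiser-zero P₀ f₀≤ = record
      { point = zero ; holds = P₀ ; minimal = λ { zero _ → ≤-refl refl ; (suc i) → f₀≤ i } }

    minimiser-suc : (m : Minimiser (P ∘ suc) (f ∘ suc)) → (P zero → f (suc (point m)) ≤F f zero) → Minimiser P f
    minimiser-suc m ≤f₀ = record
      { point = suc (point m) ; holds = holds m ; minimal = λ { zero → ≤f₀ ; (suc i) → minimal m i } }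

  argmin⊎ : ∀ {p} {n} {P : Pred (Fin n) p} → Decidable P → (f : Fin n → Carrier) →
            (∀ i → ¬ P i) ⊎ Minimiser P f
  argmin⊎ {n = ℕ.zero}  P? f = inj₁ λ ()
  argmin⊎ {n = ℕ.suc n} P? f with argmin⊎ (P? ∘ suc) (f ∘ suc) | P? zero
  ... | inj₁ ¬P₊ | no ¬P₀ = inj₁ λ { zero → ¬P₀ ; (suc i) → ¬P₊ i }
  ... | inj₁ ¬P₊ | yes P₀ = inj₂ (minimiser-zero P₀ λ i P₊ → contradiction P₊ (¬P₊ i))
  ... | inj₂ m   | no ¬P₀ = inj₂ (minimiser-suc m λ P₀ → contradiction P₀ ¬P₀)
  ... | inj₂ m   | yes P₀ = inj₂ ([ (λ f₀≤ → minimiser-zero P₀ λ i P₊ → ≤-trans f₀≤ (Minimiser.minimal m i P₊))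
                                  , (λ ≤f₀ → minimiser-suc m λ _ → ≤f₀)
                                  ]′ (≤-total (f zero) (f (suc (Minimiser.point m)))))

  argmin : ∀ {p} {n} {P : Pred (Fin n) p} → Decidable P → (f : Fin n → Carrier) → ∃ P → Minimiser P f
  argmin P? f (w , Pw) = [ (λ ¬P → contradiction Pw (¬P w)) , (λ m → m) ]′ (argmin⊎ P? f)

module Linear {c ℓ₁ ℓ₂} (K : OrderedField c ℓ₁ ℓ₂) where
  open OrderedField K hiding (zero)
  open OrderedFieldProperties K
  open Polytope K using (Point; dot)
  open SemiringSolver commutativeSemiring using (solve; _:+_; _:*_; _:=_)

  dot-linear : ∀ {d} x y (a b v : Point d) → dot (λ k → x * a k + y * b k) v ≈ x * dot a v + y * dot b v
  dot-linear {ℕ.zero}  x y a b v = sym (trans (+-cong (zeroʳ x) (zeroʳ y)) (+-identityˡ 0#))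
  dot-linear {ℕ.suc d} x y a b v =
    trans (+-congˡ (dot-linear x y (a ∘ suc) (b ∘ suc) (v ∘ suc)))
          (law x y (a zero) (b zero) (v zero) (dot (a ∘ suc) (v ∘ suc)) (dot (b ∘ suc) (v ∘ suc)))
    where
    law = solve 7 (λ x y a b v A B →
                     ((x :* a :+ y :* b) :* v :+ (x :* A :+ y :* B)) := (x :* (a :* v :+ A) :+ y :* (b :* v :+ B))) refl

  dot-neg : ∀ {d} (a v : Point d) → dot (λ k → - a k) v ≈ - dot a v
  dot-neg {ℕ.zero}  a v = sym -0≈0
  dot-neg {ℕ.suc d} a v = begin-equality
    - a zero * v zero + dot (λ k → - a (suc k)) (v ∘ suc)   ≈⟨ +-cong (sym (-‿distribˡ-* (a zero) (v zero))) (dot-neg (a ∘ suc) (v ∘ suc)) ⟩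
    - (a zero * v zero) + - dot (a ∘ suc) (v ∘ suc)          ≈⟨ -‿+-homo _ _ ⟨
    - dot a v                                                ∎
    where open RingProperties ring using (-‿distribˡ-*)

  dot-zero : ∀ {d} (v : Point d) → dot (λ _ → 0#) v ≈ 0#
  dot-zero {ℕ.zero}  v = refl
  dot-zero {ℕ.suc d} v = trans (+-cong (zeroˡ (v zero)) (dot-zero (v ∘ suc))) (+-identityˡ 0#)

  basis : ∀ {d} → Fin d → Point d
  basis zero    zero    = 1#
  basis zero    (suc _) = 0#
  basis (suc k) zero    = 0#
  basis (suc k) (suc j) = basis k j

  dot-basis : ∀ {d} (k : Fin d) (v : Point d) → dot (basis k) v ≈ v k
  dot-basis zero    v = trans (+-cong (*-identityˡ (v zero)) (dot-zero (v ∘ suc))) (+-identityʳ (v zero))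
  dot-basis (suc k) v = trans (+-cong (zeroˡ (v zero)) (dot-basis k (v ∘ suc))) (+-identityˡ (v (suc k)))

module Faces {c ℓ₁ ℓ₂} (K : OrderedField c ℓ₁ ℓ₂) {d n : ℕ} (V : Fin n → Polytope.Point K d) where
  open OrderedField K hiding (zero)
  open OrderedFieldProperties K
  open Linear K
  open Polytope K
  open RingProperties ring using (-‿distribˡ-*)
  open Equivalence using (to; from)

  infix 4 _∋_
  _∋_ : Face V → Fin n → Set ℓ₁
  X ∋ i = InFace V X i

  -- The inequality  ⟨ a , x ⟩ ≤ b , not necessarily valid on the polytope.
  Inequality : Set c
  Inequality = Point d × Carrier

  slack : Inequality → Fin n → Carrier
  slack (a , b) i = b - dot a (V i)

  inequality : Face V → Inequality
  inequality X = Face.normal X , Face.rhs X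

  faceOf : (α : Inequality) → (∀ i → 0# ≤F slack α i) → Face V
  faceOf (a , b) valid = face a b (0≤y-x⇒x≤y ∘ valid)

  slack-nonneg : ∀ X i → 0# ≤F slack (inequality X) i
  slack-nonneg X i = x≤y⇒0≤y-x (Face.valid X i)

  ∋⇒slack≈0 : ∀ X {i} → X ∋ i → slack (inequality X) i ≈ 0#
  ∋⇒slack≈0 X X∋i = trans (+-congʳ (sym X∋i)) (-‿inverseʳ _)

  slack≈0⇒∋ : ∀ X {i} → slack (inequality X) i ≈ 0# → X ∋ i
  slack≈0⇒∋ X slack≈0 = sym (y-x≈0⇒y≈x slack≈0)

  slack≉0 : ∀ X {i} → ¬ X ∋ i → ¬ slack (inequality X) i ≈ 0#
  slack≉0 X = contraposition (slack≈0⇒∋ X)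

  combine : Carrier → Inequality → Carrier → Inequality → Inequality
  combine x (a , b) y (a' , b') = (λ k → x * a k + y * a' k) , x * b + y * b'

  slack-combine : ∀ x α y β i → slack (combine x α y β) i ≈ x * slack α i + y * slack β i
  slack-combine x (a , b) y (a' , b') i =
    trans (+-congˡ (-‿cong (dot-linear x y a a' (V i)))) (combination-difference x y b b' _ _)

  -- f / slack H  on the points outside H; the junk value 0 on H is never used.
  ratio : (f : Fin n → Carrier) (H : Face V) → Decidable (H ∋_) → Fin n → Carrier
  ratio f H H? i with H? i
  ... | yes _   = 0#
  ... | no  H∌i = proj₁ (divide (f i) (slack≉0 H H∌i))

  ratio-spec : ∀ f H H? i → ¬ H ∋ i → ratio f H H? i * slack (inequality H) i ≈ f i
  ratio-spec f H H? i H∌i with H? i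
  ... | yes H∋i = contradiction H∋i H∌i
  ... | no  H∌i = proj₂ (divide (f i) (slack≉0 H H∌i))

  tight-subface : (W : Face V) → Decidable (W ∋_) → (β : Inequality) → (∀ i → W ∋ i → 0# ≤F slack β i) →
                 Σ (Face V) λ W' → ∀ i → W' ∋ i ⇔ (W ∋ i × slack β i ≈ 0#)
  tight-subface W W? β β-valid = W' , λ i → mk⇔ (W'⊆ i) (⊆W' i)
    where
    sW = slack (inequality W)
    ρ = ratio (λ i → - slack β i) W W?
    T = proj₁ (upper-bound n ρ)

    -- T bounds  - slack β / slack W  off W, so adding  T + 1  copies of W to β makes it
    -- valid, and strict off W.
    γ : Inequality
    γ = combine (T + 1#) (inequality W) 1# β

    slack-γ-on-W : ∀ {i} → W ∋ i → slack γ i ≈ slack β i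
    slack-γ-on-W {i} W∋i = begin-equality
      slack γ i                          ≈⟨ slack-combine (T + 1#) (inequality W) 1# β i ⟩
      (T + 1#) * sW i + 1# * slack β i   ≈⟨ +-cong (*-congˡ (∋⇒slack≈0 W W∋i)) (*-identityˡ (slack β i)) ⟩
      (T + 1#) * 0# + slack β i          ≈⟨ +-congʳ (zeroʳ (T + 1#)) ⟩
      0# + slack β i                     ≈⟨ +-identityˡ (slack β i) ⟩
      slack β i                          ∎

    slack-γ-off-W : ∀ {i} → ¬ W ∋ i → sW i ≤F slack γ i
    slack-γ-off-W {i} W∌i = begin
      sW i                                  ≈⟨ y-x+x≈y (slack β i) (sW i) ⟨
      sW i - slack β i + slack β i          ≈⟨ +-congʳ (+-comm (sW i) (- slack β i)) ⟩
      - slack β i + sW i + slack β i        ≈⟨ +-congʳ (+-congʳ (ratio-spec _ W W? i W∌i)) ⟨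
      ρ i * sW i + sW i + slack β i         ≲⟨ +-mono (slack β i) (+-mono (sW i) ρsW≤TsW) ⟩
      T * sW i + sW i + slack β i           ≈⟨ +-cong (+-congˡ (*-identityˡ (sW i))) (*-identityˡ (slack β i)) ⟨
      T * sW i + 1# * sW i + 1# * slack β i ≈⟨ +-congʳ (distribʳ (sW i) T 1#) ⟨
      (T + 1#) * sW i + 1# * slack β i      ≈⟨ slack-combine (T + 1#) (inequality W) 1# β i ⟨
      slack γ i                             ∎
      where
      ρsW≤TsW = *-monoˡ-≤-nonneg (slack-nonneg W i) (proj₂ (upper-bound n ρ) i)

    γ-valid : ∀ i → 0# ≤F slack γ i
    γ-valid i with W? i
    ... | yes W∋i = ≤-trans (β-valid i W∋i) (≤-refl (sym (slack-γ-on-W W∋i)))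
    ... | no  W∌i = ≤-trans (slack-nonneg W i) (slack-γ-off-W W∌i)

    W' = faceOf γ γ-valid

    W'⊆ : ∀ i → W' ∋ i → W ∋ i × slack β i ≈ 0#
    W'⊆ i W'∋i = W∋i , trans (sym (slack-γ-on-W W∋i)) γ≈0
      where
      γ≈0 = ∋⇒slack≈0 W' W'∋i
      W∋i = decidable-stable (W? i) λ W∌i →
        slack≉0 W W∌i (≤-antisym (≤-trans (slack-γ-off-W W∌i) (≤-refl γ≈0)) (slack-nonneg W i))

    ⊆W' : ∀ i → W ∋ i × slack β i ≈ 0# → W' ∋ i
    ⊆W' i (W∋i , β≈0) = slack≈0⇒∋ W' (trans (slack-γ-on-W W∋i) β≈0)

  rotation : (X H : Face V) → Decidable (H ∋_) → H ⊇F X → ∃ (λ p → ¬ H ∋ p) →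
             Σ (Face V) λ H' → H' ⊇F X × (∃ λ q → H' ∋ q × ¬ H ∋ q) × (∀ i → H ∋ i → H' ∋ i → X ∋ i)
  rotation X H H? H⊇X H∌p = H' , H'⊇X , (point , H'∋q , holds) , H∩H'⊆X
    where
    sX = slack (inequality X)
    sH = slack (inequality H)
    ρ = ratio sX H H?
    open Minimiser (argmin (¬? ∘ H?) ρ H∌p)

    -- Subtract as many copies of H from X as keeps the inequality valid.
    γ : Inequality
    γ = combine 1# (inequality X) (- ρ point) (inequality H)

    slack-γ : ∀ i → slack γ i ≈ sX i - ρ point * sH i
    slack-γ i = trans (slack-combine 1# (inequality X) (- ρ point) (inequality H) i)
                      (+-cong (*-identityˡ (sX i)) (sym (-‿distribˡ-* (ρ point) (sH i))))

    slack-γ-on-H : ∀ {i} → H ∋ i → slack γ i ≈ sX i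
    slack-γ-on-H {i} H∋i = begin-equality
      slack γ i                 ≈⟨ slack-γ i ⟩
      sX i - ρ point * sH i     ≈⟨ +-congˡ (-‿cong (*-congˡ (∋⇒slack≈0 H H∋i))) ⟩
      sX i - ρ point * 0#       ≈⟨ +-congˡ (-‿cong (zeroʳ (ρ point))) ⟩
      sX i - 0#                 ≈⟨ +-congˡ -0≈0 ⟩
      sX i + 0#                 ≈⟨ +-identityʳ (sX i) ⟩
      sX i                      ∎

    γ-valid : ∀ i → 0# ≤F slack γ i
    γ-valid i with H? i
    ... | yes H∋i = ≤-trans (slack-nonneg X i) (≤-refl (sym (slack-γ-on-H H∋i)))
    ... | no  H∌i = begin
      0#                        ≲⟨ x≤y⇒0≤y-x (begin
        ρ point * sH i            ≲⟨ *-monoˡ-≤-nonneg (slack-nonneg H i) (minimal i H∌i) ⟩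
        ρ i * sH i                ≈⟨ ratio-spec sX H H? i H∌i ⟩
        sX i                      ∎) ⟩
      sX i - ρ point * sH i     ≈⟨ slack-γ i ⟨
      slack γ i                 ∎

    H' = faceOf γ γ-valid

    H'⊇X : H' ⊇F X
    H'⊇X i X∋i = slack≈0⇒∋ H' (trans (slack-γ-on-H (H⊇X i X∋i)) (∋⇒slack≈0 X X∋i))

    H'∋q : H' ∋ point
    H'∋q = slack≈0⇒∋ H' (trans (slack-γ point)
             (trans (+-congˡ (-‿cong (ratio-spec sX H H? point holds))) (-‿inverseʳ (sX point))))

    H∩H'⊆X : ∀ i → H ∋ i → H' ∋ i → X ∋ i
    H∩H'⊆X i H∋i H'∋i = slack≈0⇒∋ X (trans (sym (slack-γ-on-H H∋i)) (∋⇒slack≈0 H' H'∋i))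

  minimising-subface : (W : Face V) → Decidable (W ∋_) → (ψ : Point d) → ∃ (W ∋_) →
                      Σ (Face V) λ W' → W ⊇F W' × ∃ (W' ∋_) ×
                        (∀ i j → W' ∋ i → W ∋ j → dot ψ (V i) ≤F dot ψ (V j))
  minimising-subface W W? ψ W∋w = W' , W⊇W' , (point , W'∋point) , minimising
    where
    open Minimiser (argmin W? (λ i → dot ψ (V i)) W∋w)
    m = dot ψ (V point)

    -- ⟨ ψ , x ⟩ ≥ m
    β : Inequality
    β = (λ k → - ψ k) , - m

    slack-β : ∀ i → slack β i ≈ dot ψ (V i) - m
    slack-β i = trans (+-congˡ (-‿cong (dot-neg ψ (V i)))) (-x--y≈y-x m (dot ψ (V i)))

    β-valid : ∀ i → W ∋ i → 0# ≤F slack β i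
    β-valid i W∋i = ≤-trans (x≤y⇒0≤y-x (minimal i W∋i)) (≤-refl (sym (slack-β i)))

    W' = proj₁ (tight-subface W W? β β-valid)
    W'-spec = proj₂ (tight-subface W W? β β-valid)

    W⊇W' : W ⊇F W'
    W⊇W' i = proj₁ ∘ to (W'-spec i)

    W'∋point : W' ∋ point
    W'∋point = from (W'-spec point) (holds , trans (slack-β point) (-‿inverseʳ m))

    minimising : ∀ i j → W' ∋ i → W ∋ j → dot ψ (V i) ≤F dot ψ (V j)
    minimising i j W'∋i W∋j = ≤-trans (≤-refl ψᵢ≈m) (minimal j W∋j)
      where
      ψᵢ≈m = y-x≈0⇒y≈x (trans (sym (slack-β i)) (proj₂ (to (W'-spec i) W'∋i)))

  Pinned : Face V → Fin d → Set ℓ₁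
  Pinned W k = ∀ i j → W ∋ i → W ∋ j → V i k ≈ V j k

  minimising-basis-pins : ∀ W W' k → W ⊇F W' →
                          (∀ i j → W' ∋ i → W ∋ j → dot (basis k) (V i) ≤F dot (basis k) (V j)) → Pinned W' k
  minimising-basis-pins W W' k W⊇W' minimising i j W'∋i W'∋j =
    ≤-antisym (below i j W'∋i W'∋j) (below j i W'∋j W'∋i)
    where
    below : ∀ i j → W' ∋ i → W' ∋ j → V i k ≤F V j k
    below i j W'∋i W'∋j = begin
      V i k               ≈⟨ dot-basis k (V i) ⟨
      dot (basis k) (V i) ≲⟨ minimising i j W'∋i (W⊇W' j W'∋j) ⟩
      dot (basis k) (V j) ≈⟨ dot-basis k (V j) ⟩
      V j k               ∎

  pin-coordinates : (ks : List (Fin d)) (W : Face V) → ∃ (W ∋_) →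
                   DoubleNegation (Σ (Face V) λ W' → W ⊇F W' × ∃ (W' ∋_) × ∀ k → k ∈ ks → Pinned W' k)
  pin-coordinates []       W W∋w = return (W , (λ _ W∋i → W∋i) , W∋w , λ _ ())
  pin-coordinates (k ∷ ks) W W∋w =
    ¬¬-decidable (W ∋_) >>= λ W? →
    let W₁ , W⊇W₁ , W₁∋w₁ , minimising = minimising-subface W W? (basis k) W∋w
        W₁-pinned = minimising-basis-pins W W₁ k W⊇W₁ minimising
    in
    pin-coordinates ks W₁ W₁∋w₁ >>= λ (W₂ , W₁⊇W₂ , W₂∋w₂ , W₂-pinned) →
    return (W₂ , (λ i → W⊇W₁ i ∘ W₁⊇W₂ i) , W₂∋w₂ , λ where
      _ (here ≡.refl) i j W₂∋i W₂∋j → W₁-pinned i j (W₁⊇W₂ i W₂∋i) (W₁⊇W₂ j W₂∋j)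
      k' (there k'∈ks) → W₂-pinned k' k'∈ks)

  vertex-within : (W : Face V) → ∃ (W ∋_) → DoubleNegation (Σ (Face V) λ w → IsVertex V w × W ⊇F w)
  vertex-within W W∋w =
    pin-coordinates (allFin d) W W∋w >>= λ (w , W⊇w , w∋u , pinned) →
    return (w , (w∋u , λ i j w∋i w∋j k → pinned k (∈-allFin k) i j w∋i w∋j) , W⊇w)

  ∋-normal-mono : ∀ F {u g} → dot (Face.normal F) (V u) ≤F dot (Face.normal F) (V g) → F ∋ u → F ∋ g
  ∋-normal-mono F {u} {g} u≤g F∋u = ≤-antisym (Face.valid F g) (≤-trans (≤-refl (sym F∋u)) u≤g)

  vertex-outside : (G F : Face V) {g : Fin n} → G ∋ g → ¬ F ∋ g →
                  DoubleNegation (Σ (Face V) λ w → IsVertex V w × G ⊇F w × ∃ λ u → w ∋ u × ¬ F ∋ u)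
  vertex-outside G F {g} G∋g F∌g =
    ¬¬-decidable (G ∋_) >>= λ G? →
    let W , G⊇W , W∋v , minimising = minimising-subface G G? (Face.normal F) (g , G∋g) in
    vertex-within W W∋v >>= λ (w , w-vertex , W⊇w) →
    let u , w∋u = proj₁ w-vertex in
    return (w , w-vertex , (λ i → G⊇W i ∘ W⊇w i) , u , w∋u ,
            F∌g ∘ ∋-normal-mono F (minimising u g (W⊇w u w∋u) G∋g))

  ProperStrictSuperface : Face V → Set (c ⊔ ℓ₁ ⊔ ℓ₂)
  ProperStrictSuperface X = Σ (Face V) λ G → IsProper V G × G ⊇F X × ∃ λ q → G ∋ q × ¬ X ∋ q

  StrictSuperfaceAvoiding : Face V → Fin n → Set (c ⊔ ℓ₁ ⊔ ℓ₂)
  StrictSuperfaceAvoiding X g = Σ (Face V) λ Y → Y ⊇F X × (∃ λ q → Y ∋ q × ¬ X ∋ q) × ¬ Y ∋ g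

  FacetAvoiding : Face V → Fin n → Set (c ⊔ ℓ₁ ⊔ ℓ₂)
  FacetAvoiding F g = Σ (Face V) λ X → IsFacet V X × X ⊇F F × ¬ X ∋ g

  ¬ProperStrictSuperface⇒IsFacet : ∀ X → Decidable (X ∋_) → IsProper V X → ¬ ProperStrictSuperface X → IsFacet V X
  ¬ProperStrictSuperface⇒IsFacet X X? X-proper ¬superface = X-proper , λ G G-proper G⊇X →
    G⊇X , λ i G∋i → decidable-stable (X? i) λ X∌i → ¬superface (G , G-proper , G⊇X , i , G∋i , X∌i)

  -- If the proper superface G contains g, rotating X inside G moves it off g.
  strict-superface-avoiding : ∀ X g → ¬ X ∋ g → ProperStrictSuperface X → DoubleNegation (StrictSuperfaceAvoiding X g)
  strict-superface-avoiding X g X∌g (G , G-proper , G⊇X , q , G∋q , X∌q) =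
    ¬¬-excluded-middle {A = G ∋ g} >>= λ where
      (no G∌g)  → return (G , G⊇X , (q , G∋q , X∌q) , G∌g)
      (yes G∋g) →
        ¬¬-¬∀⇒∃¬ G-proper >>= λ G∌p →
        ¬¬-decidable (G ∋_) >>= λ G? →
        let H , H⊇X , (q' , H∋q' , G∌q') , G∩H⊆X = rotation X G G? G⊇X G∌p in
        return (H , H⊇X , (q' , H∋q' , G∌q' ∘ G⊇X q') , X∌g ∘ G∩H⊆X g G∋g)

  Outside : Face V → List (Fin n) → Set ℓ₁
  Outside X L = ∀ i → ¬ X ∋ i → i ∈ L

  remove : Fin n → List (Fin n) → List (Fin n)
  remove q = filter (λ i → ¬? (i ≟ q))

  Outside-remove : ∀ X Y {L q} → Y ⊇F X → Y ∋ q → Outside X L → Outside Y (remove q L)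
  Outside-remove X Y {q = q} Y⊇X Y∋q X-outside i Y∌i =
    ∈-filter⁺ (λ i → ¬? (i ≟ q)) (X-outside i (Y∌i ∘ Y⊇X i)) λ { ≡.refl → Y∌i Y∋q }

  length-remove : ∀ {q} L → q ∈ L → length (remove q L) ℕ.< length L
  length-remove {q} L q∈L = filter-notAll (λ i → ¬? (i ≟ q)) L (Any.map (λ { ≡.refl i≢i → i≢i ≡.refl }) q∈L)

  facet-avoiding : ∀ F {g} → ¬ F ∋ g → DoubleNegation (FacetAvoiding F g)
  facet-avoiding F {g} F∌g =
    search (allFin n) (On.wellFounded length ℕ.<-wellFounded _) F (λ _ F∋i → F∋i) F∌g (λ i _ → ∈-allFin i)
    where
    -- L lists the points outside X, and loses one at each step.
    search : ∀ L → Acc (ℕ._<_ on length) L → ∀ X → X ⊇F F → ¬ X ∋ g → Outside X L → DoubleNegation (FacetAvoiding F g)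
    search L (acc smaller) X X⊇F X∌g X-outside =
      ¬¬-decidable (X ∋_) >>= λ X? →
      ¬¬-excluded-middle {A = ProperStrictSuperface X} >>= λ where
        (no ¬superface) →
          return (X , ¬ProperStrictSuperface⇒IsFacet X X? (λ X-whole → X∌g (X-whole g)) ¬superface , X⊇F , X∌g)
        (yes superface) →
          strict-superface-avoiding X g X∌g superface >>= λ (Y , Y⊇X , (q , Y∋q , X∌q) , Y∌g) →
          search (remove q L) (smaller (length-remove L (X-outside q X∌q)))
                 Y (λ i → Y⊇X i ∘ X⊇F i) Y∌g (Outside-remove X Y Y⊇X Y∋q X-outside)

module _ {ℓ ℓ'} {r s r' s'} (Z : Fin r → Fin s → Set ℓ) (Z' : Fin r' → Fin s' → Set ℓ') where
  open Rectangle using (IsClique)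

  IsClique-image : ∀ {m} (x : Fin m → Fin r × Fin s) (y : Fin m → Fin r' × Fin s') → IsClique Z m x →
                   (∀ a → ¬ Z' (proj₁ (y a)) (proj₂ (y a))) →
                   (∀ a b → Z (proj₁ (x a)) (proj₂ (x b)) → Z' (proj₁ (y a)) (proj₂ (y b))) →
                   IsClique Z' m y
  IsClique-image x y (_ , _ , x-adjacent) y-nonzero zero-preserved = y-injective , y-nonzero , y-adjacent
    where
    y-adjacent : ∀ a b → ¬ a ≡ b → Rectangle.RGAdj Z' (y a) (y b)
    y-adjacent a b a≢b = [ inj₁ ∘ zero-preserved a b , inj₂ ∘ zero-preserved b a ]′ (x-adjacent a b a≢b)

    -- Entries of a clique are nonzero, so no entry is adjacent to itself.
    y-injective : ∀ a b → y a ≡ y b → a ≡ b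
    y-injective a b ya≡yb = decidable-stable (a ≟ b) λ a≢b →
      [ y-nonzero a , y-nonzero a ]′ (≡.subst (Rectangle.RGAdj Z' (y a)) (≡.sym ya≡yb) (y-adjacent a b a≢b))

module _ {c ℓ₁ ℓ₂} (K : OrderedField c ℓ₁ ℓ₂) {d n : ℕ} {V : Fin n → Polytope.Point K d} where
  open Polytope K
  open Faces K V
  open NonIncidenceMatrix using (nrows; ncols; row; col; IsZero; has-facets; has-vertices)

  record Refinement (M M' : NonIncidenceMatrix V) (i : Fin (nrows M)) (j : Fin (ncols M)) : Set ℓ₁ where
    field
      row′     : Fin (nrows M')
      col′     : Fin (ncols M')
      row′⊇row : row M' row′ ⊇F row M i
      col⊇col′ : col M j ⊇F col M' col′
      nonzero  : ¬ IsZero M' row′ col′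

  nonzero-refinement : ∀ M M' i j → ¬ IsZero M i j → DoubleNegation (Refinement M M' i j)
  nonzero-refinement M M' i j nonzero =
    ¬¬-¬∀⇒∃¬ nonzero >>= λ (g , ¬[G∋g→F∋g]) →
    ¬¬-¬→ ¬[G∋g→F∋g] >>= λ (G∋g , F∌g) →
    facet-avoiding (row M i) F∌g >>= λ (X , X-facet , X⊇F , X∌g) →
    vertex-outside (col M j) X G∋g X∌g >>= λ (w , w-vertex , G⊇w , u , w∋u , X∌u) →
    let i' , row≈X = has-facets M' X X-facet
        j' , col≈w = has-vertices M' w w-vertex
    in return (record
      { row′     = i'
      ; col′     = j'
      ; row′⊇row = λ i → proj₁ row≈X i ∘ X⊇F i
      ; col⊇col′ = λ i → G⊇w i ∘ proj₂ col≈w i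
      ; nonzero  = λ row⊇col → X∌u (proj₂ row≈X u (row⊇col u (proj₁ col≈w u w∋u)))
      })

  clique-transfer : ∀ M M' m → Rectangle.HasClique (IsZero M) m → DoubleNegation (Rectangle.HasClique (IsZero M') m)
  clique-transfer M M' m (x , x-clique@(_ , x-nonzero , _)) =
    ¬¬-∀-Fin m (λ a → nonzero-refinement M M' (proj₁ (x a)) (proj₂ (x a)) (x-nonzero a)) >>= λ refined →
    let open module R a = Refinement (refined a)
        y a = row′ a , col′ a
    in return (y , IsClique-image (IsZero M) (IsZero M') x y x-clique nonzero
                     λ a b F⊇G i w∋i → row′⊇row a i (F⊇G i (col⊇col′ b i w∋i)))

  clique≤ω : ∀ M M' {m k'} → Rectangle.HasClique (IsZero M) m → ωIs K M' k' → m ℕ.≤ k'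
  clique≤ω M M' {m} {k'} clique (_ , k'-max) =
    decidable-stable (m ℕ.≤? k') (clique-transfer M M' m clique >>= return ∘ k'-max m)

proposition5p4 : ∀ {c ℓ₁ ℓ₂ : Level} (K : OrderedField c ℓ₁ ℓ₂) (d n : ℕ)
    (V : Fin n → Polytope.Point K d)
    (M M' : Polytope.NonIncidenceMatrix K V) (k k' : ℕ)
    → ωIs K M k → ωIs K M' k' → k ≡ k'
proposition5p4 K d n V M M' k k' ωM@(k-clique , _) ωM'@(k'-clique , _) =
  ℕ.≤-antisym (clique≤ω K M M' k-clique ωM') (clique≤ω K M' M k'-clique ωM)
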